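{- Let $2\le i\le n$, $b\in B_{i-1}$ and $b'\in B_i$. If $b$ and $b'$ are RS-related, then they are related.
   Context: Fix integers $n\ge1$, $0\le k\le n$. Let $X$ be the set of words of length $n$ over $\{1,2\}$ with exactly $k$ letters $1$; $S_n$ acts on $X$ by permuting positions. $\mathcal{F}$ is the space of complex functions on $X$ with action $(\sigma f)=f\circ\sigma^{ -1}$ and inner product making the delta functions orthonormal. For $1\le j\le n$, $S_j\subseteq S_n$ fixes $j+1,\dots,n$; for a Young diagram $\lambda$ with $j$ boxes, $\mathcal{F}_{j,\lambda}$ is the isotypic component of type $\lambda$ of $\mathcal{F}$ as an $S_j$-module; $\mathcal{F}^{j,c}$ ($c\in\{1,2\}$) is the span of the $\delta(x)$ with $x$ having letter $c$ in position $j$. For $1\le i\le n$, $B_i$ is an orthonormal basis of $\mathcal{F}$ consisting of one unit vector from each nonzero (hence one-dimensional) subspace $\mathcal{F}_{1,\lambda_1}\cap\cdots\cap\mathcal{F}_{i,\lambda_i}\cap\mathcal{F}^{i+1,c_{i+1}}\cap\cdots\cap\mathcal{F}^{n,c_n}$, where $\lambda_1\nearrow\cdots\nearrow\lambda_i$ is a chain of Young diagrams, identified with a standard Young tableau $Q$ with $i$ boxes, and $c_j\in\{1,2\}$. The label of such a basis element is the pair $(Q,\omega)$ with $\omega=c_{i+1}\cdots c_n$. Elements $b\in B_{i-1}$, $b'\in B_i$ are related if both lie in a subspace $\mathcal{F}_{1,\lambda_1}\cap\cdots\cap\mathcal{F}_{i-1,\lambda_{i-1}}\cap\mathcal{F}^{i+1,c_{i+1}}\cap\cdots\cap\mathcal{F}^{n,c_n}$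 for some Young diagrams $\lambda_j$ ($j$ boxes) and letters $c_j$. RS insertion step: given the label $(Q,\omega)$ of $b\in B_{i-1}$ with $\omega=c_i c_{i+1}\cdots c_n$, let $P$ be the unique semistandard tableau of the shape of $Q$ with entries in $\{1,2\}$ containing exactly $k-(\text{number of }1\text{'s in }\omega)$ entries equal to $1$; Robinson-Schensted row-insert the letter $c_i$ into $P$, producing a new shape with one added box, add a box with entry $i$ to $Q$ in that position to get $Q'$, and set $\omega'=c_{i+1}\cdots c_n$. Elements $b\in B_{i-1}$ and $b'\in B_i$ are RS-related if the label of $b'$ is $(Q',\omega')$, obtained by applying this RS insertion step to the label of $b$. -}

module Defs where

open import Level using (_⊔_)
open import Data.Bool using (Bool; true; false; if_then_else_; _∧_; _∨_; not; T)
open import Data.Bool.Properties using (T?)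
open import Data.Unit using (⊤)
open import Data.Nat using (ℕ; zero; suc; _+_; _∸_; _≤_; _<_; _<ᵇ_; _≡ᵇ_)
open import Data.Fin using (Fin; toℕ)
open import Data.Fin.Properties using () renaming (_≟_ to _≟F_)
open import Data.Vec using (Vec; []; _∷_; lookup; tabulate)
open import Data.List using (List; []; _∷_; map; concatMap; filter; foldr; length; take; _++_; [_]; allFin; reverse)
open import Data.List.Relation.Unary.All using (All)
open import Data.Maybe using (Maybe; just; nothing)
open import Data.Product using (Σ; ∃; _×_; _,_; proj₁; proj₂)
open import Relation.Nullary using (¬_; does)
open import Relation.Binary.PropositionalEquality using (_≡_)
open import Algebra.Bundles using (CommutativeRing)

-- Letters: (zero : Fin 2) is the letter 1, (suc zero) is the letter 2.
Letter : Set
Letter = Fin 2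

val : Letter → ℕ
val c = suc (toℕ c)

isOne : Letter → Bool
isOne c = toℕ c ≡ᵇ 0

onesL : List Letter → ℕ
onesL [] = 0
onesL (c ∷ cs) = (if isOne c then 1 else 0) + onesL cs

-- Words of length n; the letter in (1-indexed) position j sits at index j-1.
Word : ℕ → Set
Word n = Vec Letter n

countOnes : ∀ {n} → Word n → ℕ
countOnes [] = 0
countOnes (c ∷ w) = (if isOne c then 1 else 0) + countOnes w

Perm : ℕ → Set
Perm n = Vec (Fin n) n

allB : ∀ {n} → (Fin n → Bool) → Bool
allB {n} f = foldr (λ p b → f p ∧ b) true (allFin n)

-- injective (hence bijective)
injB : ∀ {n} → Perm n → Bool
injB σ = allB (λ p → allB (λ q → not (does (lookup σ p ≟F lookup σ q)) ∨ does (p ≟F q)))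

-- fixes every index p with toℕ p ≥ j, i.e. the positions j+1,…,n
fixesFrom : ∀ {n} → ℕ → Perm n → Bool
fixesFrom j σ = allB (λ p → (toℕ p <ᵇ j) ∨ does (lookup σ p ≟F p))

inS : ∀ {n} → ℕ → Perm n → Bool
inS j σ = injB σ ∧ fixesFrom j σ

allVecs : (n m : ℕ) → List (Vec (Fin n) m)
allVecs n zero = [] ∷ []
allVecs n (suc m) = concatMap (λ a → map (a ∷_) (allVecs n m)) (allFin n)

elemsS : (n j : ℕ) → List (Perm n)
elemsS n j = filter (λ σ → T? (inS j σ)) (allVecs n n)

isEven : ℕ → Bool
isEven zero = true
isEven (suc m) = not (isEven m)

inversions : ∀ {n} → Perm n → ℕ
inversions {n} σ =
  foldr (λ p s → foldr (λ q t → (if (toℕ p <ᵇ toℕ q) ∧ (toℕ (lookup σ q) <ᵇ toℕ (lookup σ p)) then 1 else 0) + t) s (allFin n))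
        0 (allFin n)

-- σ acts on words by moving the letter in position p to position σ p;
-- permInvW σ x = σ⁻¹ · x, whose letter at position q is x (σ q).
permInvW : ∀ {n} → Perm n → Word n → Word n
permInvW σ x = tabulate (λ q → lookup x (lookup σ q))

-- A Young diagram: list of row lengths, weakly decreasing, all positive.
IsPartition : List ℕ → Set
IsPartition [] = ⊤
IsPartition (a ∷ []) = 1 ≤ a
IsPartition (a ∷ b ∷ l) = b ≤ a × IsPartition (b ∷ l)

size : List ℕ → ℕ
size = foldr _+_ 0

-- add a box at the end of row r (rows are 0-indexed)
addBox : ℕ → List ℕ → List ℕ
addBox zero [] = 1 ∷ []
addBox zero (a ∷ l) = suc a ∷ l
addBox (suc r) [] = 0 ∷ addBox r []
addBox (suc r) (a ∷ l) = a ∷ addBox r l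

-- A standard Young tableau Q with entries 1,…,i is encoded by its row word:
-- the m-th element (0-indexed) of the list is the (0-indexed) row containing
-- the entry m+1.  The shape of the entries ≤ j is  shapeOf (take j Q), so Q
-- is the chain  λ_1 ↗ λ_2 ↗ ⋯ ↗ λ_i  with  λ_j = shapeOf (take j Q).
shapeOf : List ℕ → List ℕ
shapeOf w = foldr addBox [] (reverse w)

IsSYT : ℕ → List ℕ → Set
IsSYT i Q = length Q ≡ i × (∀ j → IsPartition (shapeOf (take j Q)))

at : ∀ {a} {A : Set a} → List A → ℕ → Maybe A
at [] _ = nothing
at (x ∷ xs) zero = just x
at (x ∷ xs) (suc m) = at xs m

-- a tableau is the list of its rows (top row first)
Tableau : Set
Tableau = List (List ℕ)

RowWeak : List ℕ → Set
RowWeak r = ∀ m x y → at r m ≡ just x → at r (suc m) ≡ just y → x ≤ y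

ColStrict : List ℕ → List ℕ → Set
ColStrict r₁ r₂ = ∀ m y → at r₂ m ≡ just y → ∃ λ x → at r₁ m ≡ just x × x < y

ColsStrict : Tableau → Set
ColsStrict [] = ⊤
ColsStrict (r ∷ []) = ⊤
ColsStrict (r₁ ∷ r₂ ∷ rs) = ColStrict r₁ r₂ × ColsStrict (r₂ ∷ rs)

IsSSYT12 : Tableau → Set
IsSSYT12 P =
  (∀ ρ r → at P ρ ≡ just r → RowWeak r × (∀ m e → at r m ≡ just e → 1 ≤ e × e ≤ 2))
  × ColsStrict P

shapeT : Tableau → List ℕ
shapeT = map length

onesT : Tableau → ℕ
onesT P = foldr _+_ 0 (map (λ r → foldr (λ e s → (if e ≡ᵇ 1 then 1 else 0) + s) 0 r) P)

insRow : ℕ → List ℕ → List ℕ × Maybe ℕ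
insRow x [] = x ∷ [] , nothing
insRow x (y ∷ ys) with x <ᵇ y
... | true = x ∷ ys , just y
... | false with insRow x ys
...   | r , m = y ∷ r , m

-- RS row insertion: new tableau and the (0-indexed) row of the new box
rsInsert : ℕ → Tableau → Tableau × ℕ
rsInsert x [] = (x ∷ []) ∷ [] , 0
rsInsert x (row ∷ rows) with insRow x row
... | r , nothing = r ∷ rows , 0
... | r , just y with rsInsert y rows
...   | t , ρ = r ∷ t , suc ρ

-- The RS insertion step: (Q , ω) ↦ (Q' , ω'), where ω = c_i c_{i+1} ⋯ c_n.
RSStep : (k : ℕ) → List ℕ → List Letter → List ℕ → List Letter → Set
RSStep k Q ω Q' ω' =
  Σ Letter λ c → Σ (List Letter) λ ωt → ω ≡ c ∷ ωt × ω' ≡ ωt ×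
  Σ Tableau λ P → IsSSYT12 P × shapeT P ≡ shapeOf Q × onesT P + onesL ω ≡ k ×
  Q' ≡ Q ++ [ proj₂ (rsInsert (val c) P) ]

-- The function space and its subspaces, over a commutative ring R
-- (meant to be a field of characteristic zero, see IsCharZeroField)

module Space {c ℓ} (R : CommutativeRing c ℓ) (n k : ℕ) where
  open CommutativeRing R renaming (_+_ to _+R_; _*_ to _*R_)

  -- functions on all words of length n; F consists of those supported on X
  Vect : Set c
  Vect = Word n → Carrier

  InF : Vect → Set ℓ
  InF v = ∀ x → ¬ countOnes x ≡ k → v x ≈ 0#

  NonZero : Vect → Set ℓ
  NonZero v = ¬ (∀ x → v x ≈ 0#)

  sumR : List Carrier → Carrier
  sumR = foldr _+R_ 0#

  -- elements of the group algebra: formal combinations Σ c_σ σ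
  GAlg : Set c
  GAlg = List (Carrier × Perm n)

  -- (σ f)(x) = f (σ⁻¹ x), extended linearly
  act : GAlg → Vect → Vect
  act a f x = sumR (map (λ cσ → proj₁ cσ *R f (permInvW (proj₂ cσ) x)) a)

  sgn : Perm n → Carrier
  sgn σ = if isEven (inversions σ) then 1# else - 1#

  -- canonical (row reading) tableau T_λ of shape λ: entry p+1 lies in
  -- row rowOf λ p and column colOf λ p
  rowOf : List ℕ → ℕ → ℕ
  rowOf [] p = 0
  rowOf (a ∷ l) p = if p <ᵇ a then 0 else suc (rowOf l (p ∸ a))

  colOf : List ℕ → ℕ → ℕ
  colOf [] p = p
  colOf (a ∷ l) p = if p <ᵇ a then p else colOf l (p ∸ a)

  preservesB : (ℕ → ℕ) → ℕ → Perm n → Bool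
  preservesB f j σ = allB (λ p → not (toℕ p <ᵇ j) ∨ (f (toℕ p) ≡ᵇ f (toℕ (lookup σ p))))

  -- a_λ = Σ_{p ∈ R(T_λ)} p ,  b_λ = Σ_{q ∈ C(T_λ)} sgn(q) q   (in ℂ[S_j])
  rowSym : ℕ → List ℕ → GAlg
  rowSym j l = map (λ σ → 1# , σ) (filter (λ σ → T? (preservesB (rowOf l) j σ)) (elemsS n j))

  colAntisym : ℕ → List ℕ → GAlg
  colAntisym j l = map (λ σ → sgn σ , σ) (filter (λ σ → T? (preservesB (colOf l) j σ)) (elemsS n j))

  youngSym : ℕ → List ℕ → Vect → Vect
  youngSym j l f = act (colAntisym j l) (act (rowSym j l) f)

  -- F_{j,λ}: the λ-isotypic component of F as S_j-module, i.e. the image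
  -- of F under the two-sided ideal of ℂ[S_j] generated by e_λ; it is the
  -- span of the vectors  g · e_λ · f  (g ∈ S_j, f ∈ F).
  Isotypic : ℕ → List ℕ → Vect → Set (c ⊔ ℓ)
  Isotypic j l v =
    ∃ λ (gs : List (Perm n × Vect)) →
      All (λ gf → T (inS j (proj₁ gf)) × InF (proj₂ gf)) gs ×
      (∀ x → v x ≈ sumR (map (λ gf → act ((1# , proj₁ gf) ∷ []) (youngSym j l (proj₂ gf)) x) gs))

  -- F^{p+1, c}: span of δ(x) with letter c at index p
  InPos : Fin n → Letter → Vect → Set ℓ
  InPos p a v = ∀ x → ¬ lookup x p ≡ a → v x ≈ 0#

  -- v ∈ F^{i+1,ω_1} ∩ ⋯ ∩ F^{n,ω_{n-i}}
  TailIn : ℕ → List Letter → Vect → Set ℓ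
  TailIn i ω v = ∀ (p : Fin n) → i ≤ toℕ p → ∀ a → at ω (toℕ p ∸ i) ≡ just a → InPos p a v

  -- v ∈ F_{1,λ_1} ∩ ⋯ ∩ F_{i,λ_i} ∩ F^{i+1,c_{i+1}} ∩ ⋯ ∩ F^{n,c_n}, where
  -- λ_1 ↗ ⋯ ↗ λ_i is Q and ω = c_{i+1} ⋯ c_n
  GTSpace : ℕ → List ℕ → List Letter → Vect → Set (c ⊔ ℓ)
  GTSpace i Q ω v = InF v × (∀ j → 1 ≤ j → j ≤ i → Isotypic j (shapeOf (take j Q)) v) × TailIn i ω v

  -- b is an element of B_i with label (Q , ω): a nonzero vector of the
  -- (one-dimensional) subspace indexed by (Q , ω)
  InBasisWithLabel : ℕ → List ℕ → List Letter → Vect → Set (c ⊔ ℓ)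
  InBasisWithLabel i Q ω b = (IsSYT i Q × length ω ≡ n ∸ i) × GTSpace i Q ω b × NonZero b

  Related : ℕ → Vect → Vect → Set (c ⊔ ℓ)
  Related i b b' =
    ∃ λ (lam : ℕ → List ℕ) → ∃ λ (cs : List Letter) →
      (∀ j → 1 ≤ j → j ≤ i ∸ 1 → IsPartition (lam j) × size (lam j) ≡ j) ×
      length cs ≡ n ∸ i × In lam cs b × In lam cs b'
    where
    In : (ℕ → List ℕ) → List Letter → Vect → Set (c ⊔ ℓ)
    In lam cs v = InF v × (∀ j → 1 ≤ j → j ≤ i ∸ 1 → Isotypic j (lam j) v) × TailIn i cs v

-- R is a field of characteristic zero (stand-in for ℂ)
module _ {c ℓ} (R : CommutativeRing c ℓ) where
  open CommutativeRing R renaming (_+_ to _+R_; _*_ to _*R_)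

  natR : ℕ → Carrier
  natR zero = 0#
  natR (suc m) = 1# +R natR m

  IsCharZeroField : Set (c ⊔ ℓ)
  IsCharZeroField = (¬ 1# ≈ 0#) × (∀ x → ¬ x ≈ 0# → ∃ λ y → x *R y ≈ 1#) × (∀ m → ¬ natR (suc m) ≈ 0#)

{-# OPTIONS --safe #-}
module Submission where

-- Relatedness only asks for the first i−1 shapes and the letters in
-- positions i+1,…,n to be shared.  An RS step turns the label (Q , c ω')
-- into (Q' , ω') with Q a prefix of Q' and ω' a suffix of c ω', so both
-- vectors lie in the subspace cut out by the chain of Q and by ω'.  Neither
-- the inserted letter, nor where its box lands, nor the field matters.

open import Defs
open import Data.Nat using (ℕ; zero; suc; _+_; _∸_; _≤_; s≤s)
open import Data.Nat.Properties using (+-suc; +-∸-assoc; m≤n⇒m⊓n≡m; ≤-trans; n≤1+n)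
open import Data.List using (List; []; _∷_; [_]; _++_; foldr; length; reverse; take)
open import Data.List.Properties using (length-reverse; length-take)
open import Data.Fin using (toℕ)
open import Data.Maybe using (just)
open import Data.Product using (_×_; _,_; proj₁)
open import Relation.Binary.PropositionalEquality using (_≡_; refl; cong; subst; sym; trans)
open import Algebra.Bundles using (CommutativeRing)

size-addBox : ∀ r l → size (addBox r l) ≡ suc (size l)
size-addBox zero    []      = refl
size-addBox zero    (a ∷ l) = refl
size-addBox (suc r) []      = size-addBox r []
size-addBox (suc r) (a ∷ l) = trans (cong (a +_) (size-addBox r l)) (+-suc a (size l))

size-foldr-addBox : ∀ w → size (foldr addBox [] w) ≡ length w
size-foldr-addBox []      = refl
size-foldr-addBox (r ∷ w) = trans (size-addBox r (foldr addBox [] w)) (cong suc (size-foldr-addBox w))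

size-shapeOf : ∀ w → size (shapeOf w) ≡ length w
size-shapeOf w = trans (size-foldr-addBox (reverse w)) (length-reverse w)

take-++ˡ : ∀ {a} {A : Set a} j (xs ys : List A) → j ≤ length xs → take j (xs ++ ys) ≡ take j xs
take-++ˡ zero    xs       ys _         = refl
take-++ˡ (suc j) (x ∷ xs) ys (s≤s j≤) = cong (x ∷_) (take-++ˡ j xs ys j≤)

IsSYT-prefix-shape : ∀ {i Q} → IsSYT i Q → ∀ j → j ≤ i →
  IsPartition (shapeOf (take j Q)) × size (shapeOf (take j Q)) ≡ j
IsSYT-prefix-shape {Q = Q} (refl , partitions) j j≤i =
  partitions j , trans (size-shapeOf (take j Q)) (trans (length-take j Q) (m≤n⇒m⊓n≡m j≤i))

module _ {c ℓ} (R : CommutativeRing c ℓ) (n k : ℕ) where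
  open Space R n k

  TailIn-uncons : ∀ {i a ω v} → TailIn i (a ∷ ω) v → TailIn (suc i) ω v
  TailIn-uncons {i} {a} {ω} tail p i<p e at≡ =
    tail p (≤-trans (n≤1+n i) i<p) e (subst (λ d → at (a ∷ ω) d ≡ just e) (sym shift) at≡)
    where
    shift : toℕ p ∸ i ≡ suc (toℕ p ∸ suc i)
    shift = +-∸-assoc 1 i<p

  Isotypic-prefix : ∀ {i Q r v} → length Q ≡ i →
    (∀ j → 1 ≤ j → j ≤ suc i → Isotypic j (shapeOf (take j (Q ++ [ r ]))) v) →
    ∀ j → 1 ≤ j → j ≤ i → Isotypic j (shapeOf (take j Q)) v
  Isotypic-prefix {Q = Q} {r} {v} refl iso j 1≤j j≤i =
    subst (λ w → Isotypic j (shapeOf w) v) (take-++ˡ j Q [ r ] j≤i) (iso j 1≤j (≤-trans j≤i (n≤1+n _)))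

  related-of-label-extension : ∀ {i Q r a ω b b'} →
    InBasisWithLabel i Q (a ∷ ω) b → InBasisWithLabel (suc i) (Q ++ [ r ]) ω b' →
    Related (suc i) b b'
  related-of-label-extension {Q = Q} {ω = ω}
    ((sytQ , _) , (inF , iso , tail) , _) ((_ , length-ω) , (inF' , iso' , tail') , _) =
    (λ j → shapeOf (take j Q)) , ω ,
    (λ j _ → IsSYT-prefix-shape sytQ j) , length-ω ,
    (inF , iso , TailIn-uncons tail) ,
    (inF' , Isotypic-prefix (proj₁ sytQ) iso' , tail')

mainTheorem5 : ∀ {c ℓ} (R : CommutativeRing c ℓ) → IsCharZeroField R →
    (n k : ℕ) → k ≤ n → (i : ℕ) → 2 ≤ i → i ≤ n →
    (Q Q' : List ℕ) (ω ω' : List Letter) (b b' : Space.Vect R n k) →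
    Space.InBasisWithLabel R n k (i ∸ 1) Q ω b →
    Space.InBasisWithLabel R n k i Q' ω' b' →
    RSStep k Q ω Q' ω' →
    Space.Related R n k i b b'
mainTheorem5 R _ n k _ (suc _) (s≤s _) _ _ _ _ _ _ _ label label'
  (_ , _ , refl , refl , _ , _ , _ , _ , refl) =
  related-of-label-extension R n k label label'
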